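{- Let $D$ be a finite distributive lattice and let $k\geq 2$ be an integer. Then \[ \gamma(D^k)=\min\{\,n\in\mathbb{N}_0:\ k\,J(D)\ \text{order-embeds into}\ (\mathcal{P}([n]);\subseteq)\,\}, \] where $\gamma(L)$ denotes the minimum size of a generating set of a finite lattice $L$, $J(D)$ is the poset of join-irreducible elements of $D$, and $k\,J(D)$ is the cardinal sum of $k$ copies of $J(D)$.
   Context: $\mathbb{N}_0=\{0,1,2,\dots\}$; $[n]=\{1,\dots,n\}$ and $[0]=\emptyset$; $\mathcal{P}([n])$ is the powerset lattice of $[n]$ ordered by inclusion. $D^k$ is the $k$-th direct power of $D$ with componentwise operations. A subset $Y$ of a lattice $L$ is a generating set if no proper sublattice of $L$ contains $Y$; $\gamma(L)=\min\{|Y|: Y \text{ generates } L\}$. An element $x$ of a finite lattice is join-irreducible if it covers exactly one element (so $0\notin J(D)$); $J(D)$ carries the order inherited from $D$. For a poset $U$ and $k\in\mathbb{N}$, the cardinal sum $kU$ is the disjoint union of $k$ isomorphic copies of $U$, where elements in different copies are incomparable. An order embedding $\phi:U_1\to U_2$ is a map with $x\le y\iff \phi(x)\le\phi(y)$. -}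

module Defs where

open import Level using (Level; _⊔_)
open import Data.Nat using (ℕ; _≤_)
open import Data.Fin using (Fin)
open import Data.Fin.Subset using (Subset; _⊆_)
open import Data.Product using (Σ; ∃; _×_; _,_)
open import Relation.Nullary using (¬_)
open import Relation.Binary.PropositionalEquality using (_≡_)
import Relation.Binary.PropositionalEquality as ≡
open import Function.Definitions using (Injective)
open import Function.Bundles using (Inverse; _⇔_)
open import Algebra.Lattice.Bundles using (DistributiveLattice)
open import Algebra.Lattice.Bundles.Raw using (RawLattice)

private variable c ℓ : Level

IsFinite : DistributiveLattice c ℓ → ℕ → Set (c ⊔ ℓ)
IsFinite D m = Inverse (DistributiveLattice.setoid D) (≡.setoid (Fin m))

power : RawLattice c ℓ → ℕ → RawLattice c ℓ
power L k = record
  { Carrier = Fin k → Carrier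
  ; _≈_ = λ f g → ∀ i → f i ≈ g i
  ; _∧_ = λ f g i → f i ∧ g i
  ; _∨_ = λ f g i → f i ∨ g i
  }
  where open RawLattice L

module _ (L : RawLattice c ℓ) where
  open RawLattice L

  record IsSublattice (S : Carrier → Set (c ⊔ ℓ)) : Set (c ⊔ ℓ) where
    field
      nonempty : Σ Carrier S
      resp     : ∀ {x y} → x ≈ y → S x → S y
      ∧-closed : ∀ {x y} → S x → S y → S (x ∧ y)
      ∨-closed : ∀ {x y} → S x → S y → S (x ∨ y)

  Generates : ∀ {n} → (Fin n → Carrier) → Set _
  Generates g = ∀ (S : Carrier → Set (c ⊔ ℓ)) → IsSublattice S →
                (∀ i → S (g i)) → ∀ x → S x

  HasGenSetOfSize : ℕ → Set _
  HasGenSetOfSize n = Σ (Fin n → Carrier) λ g → Injective _≡_ _≈_ g × Generates g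

module _ (D : DistributiveLattice c ℓ) where
  open DistributiveLattice D

  _≤D_ : Carrier → Carrier → Set ℓ
  x ≤D y = (x ∧ y) ≈ x

  _<D_ : Carrier → Carrier → Set ℓ
  x <D y = x ≤D y × ¬ (x ≈ y)

  Covers : Carrier → Carrier → Set (c ⊔ ℓ)
  Covers x y = y <D x × (∀ z → ¬ (y <D z × z <D x))

  JoinIrreducible : Carrier → Set (c ⊔ ℓ)
  JoinIrreducible x = Σ Carrier λ y → Covers x y × (∀ z → Covers x z → z ≈ y)

  J : Set (c ⊔ ℓ)
  J = Σ Carrier JoinIrreducible

  kJ : ℕ → Set (c ⊔ ℓ)
  kJ k = Fin k × J

  _≤kJ_ : ∀ {k} → kJ k → kJ k → Set ℓ
  (i , (x , _)) ≤kJ (j , (y , _)) = i ≡ j × x ≤D y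

  OrderEmbedsInto : ℕ → ℕ → Set (c ⊔ ℓ)
  OrderEmbedsInto k n = Σ (kJ k → Subset n) λ φ →
    ∀ a b → (a ≤kJ b) ⇔ (φ a ⊆ φ b)

IsLeast : ∀ {p} → (ℕ → Set p) → ℕ → Set p
IsLeast P n = P n × (∀ m → P m → n ≤ m)

-- If g₁, …, gₙ generate Dᵏ, then (i , p) ↦ {j : p ≰ gⱼ i} order-embeds k J(D)
-- into P([n]): for join-irreducible (hence join-prime) p′ the vectors x with
-- p′ ≤ x i′ ⇒ p ≤ x i form a sublattice, so they contain everything.  Conversely, given an
-- embedding φ, put gⱼ l = ⋁ {q ∈ J(D) : j ∉ φ (l , q)}.  Since k ≥ 2, no φ (i , p) is full,
-- and the meet of the gⱼ with j ∉ φ (i , p) is the vector with p at i and ⊥ elsewhere; by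
-- Birkhoff every element of Dᵏ is a join of such vectors, so the gⱼ generate.  Embeddability
-- into P([n]) is decidable and holds for n = k + m, so a least such n exists; removing
-- repetitions from the corresponding generators cannot go below it.

{-# OPTIONS --safe #-}
module Submission where

open import Defs
open import Level using (Level; _⊔_; Lift; lift; lower)
open import Algebra.Lattice.Bundles using (Lattice; DistributiveLattice)
open import Algebra.Lattice.Bundles.Raw using (RawLattice)
import Algebra.Lattice.Properties.Lattice as LatticeProperties
open import Data.Bool using (true)
open import Data.Nat as ℕ using (ℕ; zero; suc; z≤n; s≤s)
import Data.Nat.Properties as ℕ
import Data.Nat.Induction as ℕ
open import Data.Fin as Fin using (Fin)
import Data.Fin.Properties as Fin
open import Data.Fin.Subset using (Subset; _∈_; _∉_; _⊆_; _⊂_; ∣_∣) renaming (⊥ to ∅)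
import Data.Fin.Subset.Properties as Subset
open import Data.Product using (Σ; ∃; _×_; _,_; proj₁; proj₂; map₁)
open import Data.Product.Function.NonDependent.Propositional using (_×-⇔_)
open import Data.Sum using (_⊎_; inj₁; inj₂; [_,_]′)
open import Data.Vec as Vec using (Vec; []; _∷_; tabulate; lookup)
import Data.Vec.Properties as Vec
open import Data.Vec.Functional as Vector using (foldr)
import Data.Vec.Functional.Relation.Binary.Pointwise.Properties as Pointwise
open import Function using (_∘_; flip)
open import Function.Bundles using (_⇔_; mk⇔; Equivalence; Inverse)
open import Function.Definitions using (Injective)
import Function.Properties.Equivalence as ⇔
open import Induction.WellFounded using (WellFounded; Acc; acc; module Subrelation)
open import Relation.Binary.Bundles using (DecSetoid; Poset)
open import Relation.Binary.Definitions using (_Respects_)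
import Relation.Binary.Definitions as B
import Relation.Binary.Construct.Flip.EqAndOrd as Flip
import Relation.Binary.Construct.On as On
import Relation.Binary.Lattice as OrderTheoretic
import Relation.Binary.Properties.Poset as PosetProperties
open import Relation.Binary.PropositionalEquality as ≡ using (_≡_; _≢_)
import Relation.Binary.Reasoning.PartialOrder as ≤-Reasoning
open import Relation.Nullary using (¬_; contradiction; Dec; yes; no; does; _×-dec_; _→-dec_; ¬?)
open import Relation.Nullary.Decidable using (dec-true; map′; decidable-stable)
open import Relation.Unary using (Pred; Decidable)

private variable
  a p : Level
  A B : Set a

ifDec : Dec A → (A → B) → B → B
ifDec (yes x) f y = f x
ifDec (no _)  f y = y

module _ {P : B → Set p} {f : A → B} {y : B} where

  ifDec-intro : ∀ d → (∀ x → P (f x)) → (¬ A → P y) → P (ifDec d f y)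
  ifDec-intro (yes x) Pf Py = Pf x
  ifDec-intro (no ¬x) Pf Py = Py ¬x

  ifDec-elim : ∀ d → P (ifDec d f y) → (∃ λ x → P (f x)) ⊎ (¬ A × P y)
  ifDec-elim (yes x) Pfx = inj₁ (x , Pfx)
  ifDec-elim (no ¬x) Py  = inj₂ (¬x , Py)

_⇔-dec_ : Dec A → Dec B → Dec (A ⇔ B)
a? ⇔-dec b? = map′ (λ (f , g) → mk⇔ f g) (λ e → Equivalence.to e , Equivalence.from e)
                   ((a? →-dec b?) ×-dec (b? →-dec a?))

module _ {m} {P : Pred (Fin m) p} (P? : Decidable P) where

  subsetOf : Subset m
  subsetOf = tabulate (does ∘ P?)

  ∈-subsetOf : ∀ {t} → t ∈ subsetOf ⇔ P t
  ∈-subsetOf {t} = mk⇔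
    (λ t∈ → true⇒ {P? t} (≡.trans (≡.sym lookup-t) (Vec.[]=⇒lookup t∈)))
    (λ Pt → Vec.lookup⇒[]= t _ (≡.trans lookup-t (dec-true (P? t) Pt)))
    where
    lookup-t : lookup subsetOf t ≡ does (P? t)
    lookup-t = Vec.lookup∘tabulate _ t
    true⇒ : ∀ {d : Dec (P t)} → does d ≡ true → P t
    true⇒ {yes Pt} _ = Pt

Searchable : ∀ p → Set → Set (Level.suc p)
Searchable p A = ∀ {P : Pred A p} → Decidable P → Dec (∃ P)

searchable-Vec : Searchable p A → ∀ n → Searchable p (Vec A n)
searchable-Vec any? zero    P? = map′ ([] ,_) (λ { ([] , P[]) → P[] }) (P? [])
searchable-Vec any? (suc n) P? =
  map′ (λ (x , xs , Pxxs) → x ∷ xs , Pxxs) (λ { (x ∷ xs , Pxxs) → x , xs , Pxxs })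
       (any? λ x → searchable-Vec any? n (P? ∘ (x ∷_)))

least : ∀ {P : Pred ℕ p} → Decidable P → ∀ {n} → P n → ∃ (IsLeast P)
least {P = P} P? {n} = go n (ℕ.<-wellFounded n)
  where
  go : ∀ n → Acc ℕ._<_ n → P n → ∃ (IsLeast P)
  go n (acc below) Pn with ℕ.anyUpTo? P? n
  ... | yes (n′ , n′<n , Pn′) = go n′ (below n′<n) Pn′
  ... | no ∄ = n , Pn , λ n′ Pn′ → ℕ.≮⇒≥ λ n′<n → ∄ (n′ , n′<n , Pn′)

foldr-pointwise : ∀ {I : Set a} (_∙_ : B → B → B) {n} (e : I → B) (f : Fin n → I → B) i →
                  foldr (λ x y i → x i ∙ y i) e f i ≡ foldr _∙_ (e i) (λ j → f j i)
foldr-pointwise _∙_ {zero}  e f i = ≡.refl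
foldr-pointwise _∙_ {suc n} e f i = ≡.cong (f Fin.zero i ∙_) (foldr-pointwise _∙_ e (f ∘ Fin.suc) i)

another : ∀ {k} → 2 ℕ.≤ k → (i : Fin k) → ∃ λ i′ → i′ ≢ i
another (s≤s (s≤s _)) Fin.zero    = Fin.suc Fin.zero , λ ()
another (s≤s (s≤s _)) (Fin.suc _) = Fin.zero , λ ()

module _ {ℓ} (S : DecSetoid a ℓ) where
  open DecSetoid S

  deduplicate : ∀ {n} (f : Fin n → Carrier) →
    ∃ λ n′ → n′ ℕ.≤ n × Σ (Fin n′ → Carrier) λ g →
      Injective _≡_ _≈_ g × (∀ i → ∃ λ j → f i ≈ g j)
  deduplicate {zero} f = 0 , z≤n , (λ ()) , (λ { {()} }) , λ ()
  deduplicate {suc n} f with deduplicate (f ∘ Fin.suc)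
  ... | n′ , n′≤n , g , g-inj , f⊆g with Fin.any? (λ j → f Fin.zero ≟ g j)
  ...   | yes (j , f₀≈gj) = n′ , ℕ.m≤n⇒m≤1+n n′≤n , g , g-inj ,
                            λ { Fin.zero → j , f₀≈gj ; (Fin.suc i) → f⊆g i }
  ...   | no f₀∉g = suc n′ , s≤s n′≤n , f Fin.zero Vector.∷ g , inj ,
                    λ { Fin.zero → Fin.zero , refl
                      ; (Fin.suc i) → Fin.suc (proj₁ (f⊆g i)) , proj₂ (f⊆g i) }
    where
    inj : Injective _≡_ _≈_ (f Fin.zero Vector.∷ g)
    inj {Fin.zero}  {Fin.zero}  _ = ≡.refl
    inj {Fin.zero}  {Fin.suc j} e = contradiction (j , e) f₀∉g
    inj {Fin.suc i} {Fin.zero}  e = contradiction (i , sym e) f₀∉g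
    inj {Fin.suc i} {Fin.suc j} e = ≡.cong Fin.suc (g-inj e)

module BigOperators {c ℓ} (L : RawLattice c ℓ) where
  open RawLattice L

  ⋁[_]_ ⋀[_]_ : ∀ {n} → Carrier → (Fin n → Carrier) → Carrier
  ⋁[ e ] f = foldr _∨_ e f
  ⋀[ e ] f = foldr _∧_ e f

  module _ {S : Pred Carrier (c ⊔ ℓ)} (S-sub : IsSublattice L S) where
    open IsSublattice S-sub

    ⋁-closed : ∀ {n e} {f : Fin n → Carrier} → S e → (∀ j → S (f j)) → S (⋁[ e ] f)
    ⋁-closed {zero}  Se Sf = Se
    ⋁-closed {suc n} Se Sf = ∨-closed (Sf Fin.zero) (⋁-closed Se (Sf ∘ Fin.suc))

    ⋀-closed : ∀ {n e} {f : Fin n → Carrier} → S e → (∀ j → S (f j)) → S (⋀[ e ] f)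
    ⋀-closed {zero}  Se Sf = Se
    ⋀-closed {suc n} Se Sf = ∧-closed (Sf Fin.zero) (⋀-closed Se (Sf ∘ Fin.suc))

module LatticeOrder {c ℓ} (L : Lattice c ℓ) where
  open Lattice L
  open LatticeProperties L using (poset; ∨-∧-isOrderTheoreticLattice)
  open Poset poset public using (_≤_; ≤-respˡ-≈; ≤-respʳ-≈)
    renaming (refl to ≤-refl; reflexive to ≤-reflexive; trans to ≤-trans; antisym to ≤-antisym)
  open OrderTheoretic.IsLattice ∨-∧-isOrderTheoreticLattice public
    using (x≤x∨y; y≤x∨y; ∨-least; x∧y≤x; x∧y≤y; ∧-greatest)
  open BigOperators rawLattice public

  JoinPrime : Pred Carrier (c ⊔ ℓ)
  JoinPrime p = ∀ {x y} → p ≤ x ∨ y → p ≤ x ⊎ p ≤ y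

  ≤-⋁ : ∀ {n} e (f : Fin n → Carrier) j → f j ≤ ⋁[ e ] f
  ≤-⋁ e f Fin.zero    = x≤x∨y _ _
  ≤-⋁ e f (Fin.suc j) = ≤-trans (≤-⋁ e (f ∘ Fin.suc) j) (y≤x∨y _ _)

  ⋁-prime : ∀ {n e} {f : Fin n → Carrier} {p} → JoinPrime p →
            p ≤ ⋁[ e ] f → p ≤ e ⊎ ∃ λ j → p ≤ f j
  ⋁-prime {zero}  p-prime p≤ = inj₁ p≤
  ⋁-prime {suc n} p-prime p≤ with p-prime p≤
  ... | inj₁ p≤f₀ = inj₂ (Fin.zero , p≤f₀)
  ... | inj₂ p≤⋁ with ⋁-prime p-prime p≤⋁
  ...   | inj₁ p≤e = inj₁ p≤e
  ...   | inj₂ (j , p≤fj) = inj₂ (Fin.suc j , p≤fj)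

  ⋀-≤ : ∀ {n} e (f : Fin n → Carrier) j → ⋀[ e ] f ≤ f j
  ⋀-≤ e f Fin.zero    = x∧y≤x _ _
  ⋀-≤ e f (Fin.suc j) = ≤-trans (x∧y≤y _ _) (⋀-≤ e (f ∘ Fin.suc) j)

  ⋀-greatest : ∀ {n e} {f : Fin n → Carrier} {x} → x ≤ e → (∀ j → x ≤ f j) → x ≤ ⋀[ e ] f
  ⋀-greatest {zero}  x≤e x≤f = x≤e
  ⋀-greatest {suc n} x≤e x≤f = ∧-greatest (x≤f Fin.zero) (⋀-greatest x≤e (x≤f ∘ Fin.suc))

  module DirectPower (k : ℕ) where
    open BigOperators (power rawLattice k) public
      renaming (⋁[_]_ to ⋁ᵏ[_]_; ⋀[_]_ to ⋀ᵏ[_]_; ⋁-closed to ⋁ᵏ-closed; ⋀-closed to ⋀ᵏ-closed)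

    module _ {n} (e : Fin k → Carrier) (f : Fin n → Fin k → Carrier) (l : Fin k) where

      ≤-⋁ᵏ : ∀ j → f j l ≤ (⋁ᵏ[ e ] f) l
      ≤-⋁ᵏ j = ≡.subst (f j l ≤_) (≡.sym (foldr-pointwise _∨_ e f l))
                       (≤-⋁ (e l) (λ j → f j l) j)

      ⋁ᵏ-prime : ∀ {p} → JoinPrime p → p ≤ (⋁ᵏ[ e ] f) l → p ≤ e l ⊎ ∃ λ j → p ≤ f j l
      ⋁ᵏ-prime {p} p-prime = ⋁-prime p-prime ∘ ≡.subst (p ≤_) (foldr-pointwise _∨_ e f l)

      ⋀ᵏ-≤ : ∀ j → (⋀ᵏ[ e ] f) l ≤ f j l
      ⋀ᵏ-≤ j = ≡.subst (_≤ f j l) (≡.sym (foldr-pointwise _∧_ e f l))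
                       (⋀-≤ (e l) (λ j → f j l) j)

      ⋀ᵏ-greatest : ∀ {x} → x ≤ e l → (∀ j → x ≤ f j l) → x ≤ (⋀ᵏ[ e ] f) l
      ⋀ᵏ-greatest {x} x≤e x≤f =
        ≡.subst (x ≤_) (≡.sym (foldr-pointwise _∧_ e f l)) (⋀-greatest x≤e x≤f)

module FinitePoset {c ℓ₁ ℓ₂} (P : Poset c ℓ₁ ℓ₂) (_≤?_ : B.Decidable (Poset._≤_ P))
                   {m} (from : Fin m → Poset.Carrier P) (to : Poset.Carrier P → Fin m)
                   (from-to : ∀ x → Poset._≈_ P (from (to x)) x) where
  open Poset P
  open PosetProperties P using (_<_; <-respˡ-≈; ≤-dec⇒≈-dec)

  _<?_ : B.Decidable _<_
  x <? y = (x ≤? y) ×-dec ¬? (≤-dec⇒≈-dec _≤?_ x y)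

  ↓_ : Carrier → Subset m
  ↓ x = subsetOf (λ t → from t ≤? x)

  ↓-⊂ : ∀ {x y} → x < y → ↓ x ⊂ ↓ y
  ↓-⊂ {x} {y} (x≤y , x≉y) =
    (λ t∈↓x → ∈↓.from (trans (∈↓.to t∈↓x) x≤y)) ,
    to y , ∈↓.from (reflexive (from-to y)) ,
    λ ty∈↓x → x≉y (antisym x≤y (≤-respˡ-≈ (from-to y) (∈↓.to ty∈↓x)))
    where module ∈↓ {t z} = Equivalence (∈-subsetOf (λ t → from t ≤? z) {t})

  <-wellFounded : WellFounded _<_
  <-wellFounded = Subrelation.wellFounded (Subset.p⊂q⇒∣p∣<∣q∣ ∘ ↓-⊂)
                                          (On.wellFounded (∣_∣ ∘ ↓_) ℕ.<-wellFounded)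

  minimal : ∀ {q} {Q : Pred Carrier q} → Decidable Q → Q Respects _≈_ →
            ∀ {x} → Q x → ∃ λ z → Q z × (∀ {w} → w < z → ¬ Q w)
  minimal {Q = Q} Q? Q-resp {x} = go x (<-wellFounded x)
    where
    go : ∀ x → Acc _<_ x → Q x → ∃ λ z → Q z × (∀ {w} → w < z → ¬ Q w)
    go x (acc below) Qx with Fin.any? (λ t → (from t <? x) ×-dec Q? (from t))
    ... | yes (t , t<x , Qt) = go (from t) (below t<x) Qt
    ... | no ∄ = x , Qx , λ {w} w<x Qw →
      ∄ (to w , <-respˡ-≈ (Eq.sym (from-to w)) w<x , Q-resp (Eq.sym (from-to w)) Qw)

module FiniteDistributiveLattice {c ℓ} (D : DistributiveLattice c ℓ) {m} (fin : IsFinite D m) where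
  open DistributiveLattice D
  open LatticeOrder lattice public
  open LatticeProperties lattice using (poset)
  open PosetProperties poset public using (_<_; <-respˡ-≈; <-respʳ-≈; <⇒≱)
  open Inverse fin public using (to; from) renaming (strictlyInverseʳ to from-to)
  open Inverse fin using (to-cong)

  _≈?_ : B.Decidable _≈_
  x ≈? y = map′ (λ tx≡ty → trans (sym (from-to x)) (trans (reflexive (≡.cong from tx≡ty)) (from-to y)))
                to-cong (to x Fin.≟ to y)

  decSetoid : DecSetoid c ℓ
  decSetoid = record { isDecEquivalence = record { isEquivalence = isEquivalence ; _≟_ = _≈?_ } }

  _≤?_ : B.Decidable _≤_
  x ≤? y = x ≈? (x ∧ y)

  ≤D⇔≤ : ∀ {x y} → _≤D_ D x y ⇔ x ≤ y
  ≤D⇔≤ = mk⇔ sym sym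

  <D⇔< : ∀ {x y} → _<D_ D x y ⇔ x < y
  <D⇔< = mk⇔ (map₁ sym) (map₁ sym)

  open FinitePoset poset _≤?_ from to from-to public using (_<?_; minimal)
  open FinitePoset (Flip.poset poset) (flip _≤?_) from to from-to public
    using () renaming (minimal to maximal)

  JoinIrreducible′ : Pred Carrier (c ⊔ ℓ)
  JoinIrreducible′ p = ∃ λ y → y < p × (∀ {w} → w < p → w ≤ y)

  joinIrreducible⇒′ : ∀ {p} → JoinIrreducible D p → JoinIrreducible′ p
  joinIrreducible⇒′ {p} (y , (y<p , _) , unique) = y , Equivalence.to <D⇔< y<p , below-y
    where
    below-y : ∀ {w} → w < p → w ≤ y
    below-y {w} w<p with maximal {Q = λ z → w ≤ z × z < p}
                                 (λ z → (w ≤? z) ×-dec (z <? p))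
                                 (λ z≈z′ (w≤z , z<p) → ≤-respʳ-≈ z≈z′ w≤z , <-respˡ-≈ z≈z′ z<p)
                                 (≤-refl , w<p)
    ... | z , (w≤z , z<p) , maximal-z = ≤-trans w≤z (≤-reflexive (unique z (p-covers-z)))
      where
      p-covers-z : Covers D p z
      p-covers-z = Equivalence.from <D⇔< z<p , λ u (z<u , u<p) →
        let z≤u , z≉u = Equivalence.to <D⇔< z<u
        in maximal-z (z≤u , z≉u ∘ sym) (≤-trans w≤z z≤u , Equivalence.to <D⇔< u<p)

  joinIrreducible′⇒ : ∀ {p} → JoinIrreducible′ p → JoinIrreducible D p
  joinIrreducible′⇒ {p} (y , y<p , below-y) =
    y , (Equivalence.from <D⇔< y<p , no-between) , unique
    where
    no-between : ∀ z → ¬ (_<D_ D y z × _<D_ D z p)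
    no-between z (y<z , z<p) = <⇒≱ (Equivalence.to <D⇔< y<z) (below-y (Equivalence.to <D⇔< z<p))
    unique : ∀ z → Covers D p z → z ≈ y
    unique z (z<p , covers) with z ≈? y
    ... | yes z≈y = z≈y
    ... | no z≉y =
      contradiction (Equivalence.from <D⇔< (z≤y , z≉y) , Equivalence.from <D⇔< y<p) (covers y)
      where z≤y = below-y (Equivalence.to <D⇔< z<p)

  joinIrreducible′? : Decidable JoinIrreducible′
  joinIrreducible′? p = map′ found (λ (y , y<p , below-y) → to y , <-respˡ-≈ (sym (from-to y)) y<p ,
                                      λ s s<p → ≤-respʳ-≈ (sym (from-to y)) (below-y s<p))
    (Fin.any? λ t → (from t <? p) ×-dec Fin.all? λ s → (from s <? p) →-dec (from s ≤? from t))
    where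
    found : (∃ λ t → from t < p × ∀ s → from s < p → from s ≤ from t) → JoinIrreducible′ p
    found (t , t<p , below-t) = from t , t<p , λ {w} w<p →
      ≤-respˡ-≈ (from-to w) (below-t (to w) (<-respˡ-≈ (sym (from-to w)) w<p))

  joinIrreducible? : Decidable (JoinIrreducible D)
  joinIrreducible? p = map′ joinIrreducible′⇒ joinIrreducible⇒′ (joinIrreducible′? p)

  joinIrreducible-resp : JoinIrreducible D Respects _≈_
  joinIrreducible-resp p≈q p-ji with joinIrreducible⇒′ p-ji
  ... | y , y<p , below-y = joinIrreducible′⇒ (y , <-respʳ-≈ p≈q y<p , below-y ∘ <-respʳ-≈ (sym p≈q))

  joinIrreducible′⇒joinPrime : ∀ {p} → JoinIrreducible′ p → JoinPrime p
  joinIrreducible′⇒joinPrime {p} (y , y<p , below-y) {a} {b} p≤a∨b with p ≤? a | p ≤? b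
  ... | yes p≤a | _       = inj₁ p≤a
  ... | no _    | yes p≤b = inj₂ p≤b
  ... | no p≰a  | no p≰b  = contradiction (begin
    p                 ≈⟨ p≤a∨b ⟩
    p ∧ (a ∨ b)       ≈⟨ ∧-distribˡ-∨ p a b ⟩
    (p ∧ a) ∨ (p ∧ b) ≤⟨ ∨-least (below-y (meet-below p≰a)) (below-y (meet-below p≰b)) ⟩
    y                 ∎) (<⇒≱ y<p)
    where
    open ≤-Reasoning poset
    meet-below : ∀ {x} → ¬ p ≤ x → p ∧ x < p
    meet-below p≰x = x∧y≤x _ _ , p≰x ∘ sym

  joinIrreducible⇒joinPrime : ∀ {p} → JoinIrreducible D p → JoinPrime p
  joinIrreducible⇒joinPrime p-ji = joinIrreducible′⇒joinPrime (joinIrreducible⇒′ p-ji)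

  ≤-viaJoinIrreducibles : ∀ {x y} → (∀ {p} → JoinIrreducible D p → p ≤ x → p ≤ y) → x ≤ y
  ≤-viaJoinIrreducibles {x} {y} ji≤x⇒≤y with x ≤? y
  ... | yes x≤y = x≤y
  ... | no x≰y with minimal {Q = λ z → z ≤ x × ¬ z ≤ y} (λ z → (z ≤? x) ×-dec ¬? (z ≤? y))
                            (λ z≈z′ (z≤x , z≰y) → ≤-respˡ-≈ z≈z′ z≤x , z≰y ∘ ≤-respˡ-≈ (sym z≈z′))
                            (≤-refl , x≰y)
  ...   | z , (z≤x , z≰y) , minimal-z = contradiction (ji≤x⇒≤y z-ji z≤x) z≰y
    where
    z-ji : JoinIrreducible D z
    z-ji = joinIrreducible′⇒ (z ∧ y , (x∧y≤x _ _ , z≰y ∘ sym) , λ {w} (w≤z , w≉z) →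
      ∧-greatest w≤z (decidable-stable (w ≤? y) (minimal-z (w≤z , w≉z) ∘ (≤-trans w≤z z≤x ,_))))

  module Bottom (x₀ : Carrier) where

    ⊥ : Carrier
    ⊥ = ⋀[ x₀ ] from

    ⊥-minimum : ∀ x → ⊥ ≤ x
    ⊥-minimum x = ≤-respʳ-≈ (from-to x) (⋀-≤ x₀ from (to x))

    joinIrreducible⇒≰⊥ : ∀ {p} → JoinIrreducible D p → ¬ p ≤ ⊥
    joinIrreducible⇒≰⊥ p-ji p≤⊥ with joinIrreducible⇒′ p-ji
    ... | y , y<p , _ = <⇒≱ y<p (≤-trans p≤⊥ (⊥-minimum y))

module Power {c ℓ} (D : DistributiveLattice c ℓ) {m} (fin : IsFinite D m) (k : ℕ) where
  open DistributiveLattice D using (Carrier; _≈_; rawLattice; sym)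
  open FiniteDistributiveLattice D fin
  open DirectPower k

  Dᵏ : RawLattice c ℓ
  Dᵏ = power rawLattice k

  implicationSublattice : ∀ i p i′ {p′} → JoinIrreducible D p′ →
                          IsSublattice Dᵏ (λ x → Lift c (p′ ≤ x i′ → p ≤ x i))
  implicationSublattice i p i′ p′-ji = record
    { nonempty = (λ _ → p) , lift (λ _ → ≤-refl)
    ; resp     = λ x≈y Sx → lift λ p′≤yi′ →
                   ≤-respʳ-≈ (x≈y i) (lower Sx (≤-respʳ-≈ (sym (x≈y i′)) p′≤yi′))
    ; ∧-closed = λ Sx Sy → lift λ p′≤ →
                   ∧-greatest (lower Sx (≤-trans p′≤ (x∧y≤x _ _)))
                              (lower Sy (≤-trans p′≤ (x∧y≤y _ _)))
    ; ∨-closed = λ Sx Sy → lift λ p′≤ →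
                   [ (λ p′≤x → ≤-trans (lower Sx p′≤x) (x≤x∨y _ _))
                   , (λ p′≤y → ≤-trans (lower Sy p′≤y) (y≤x∨y _ _)) ]′
                   (joinIrreducible⇒joinPrime p′-ji p′≤)
    }

  generating⇒orderEmbedding : ∀ {n} {g : Fin n → Fin k → Carrier} → Generates Dᵏ g →
                              OrderEmbedsInto D k n
  generating⇒orderEmbedding {n} {g} g-generates = φ , λ a b → mk⇔ (φ-mono a b) (φ-reflects a b)
    where
    φ : kJ D k → Subset n
    φ (i , p , _) = subsetOf (λ j → ¬? (p ≤? g j i))

    module ∈φ {i p j} = Equivalence (∈-subsetOf (λ j → ¬? (p ≤? g j i)) {j})

    φ-mono : ∀ a b → _≤kJ_ D a b → φ a ⊆ φ b
    φ-mono (i , p , _) (.i , p′ , _) (≡.refl , p≤p′) j∈φa =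
      ∈φ.from λ p′≤gj → ∈φ.to j∈φa (≤-trans (Equivalence.to ≤D⇔≤ p≤p′) p′≤gj)

    -- Since g generates, every x satisfies p′ ≤ x i′ ⇒ p ≤ x i: test this on the constant p′
    -- and, to exclude i ≢ i′, on the spike with p′ at i′ and a lower cover y of p elsewhere.
    φ-reflects : ∀ a b → φ a ⊆ φ b → _≤kJ_ D a b
    φ-reflects (i , p , (y , (y<p , _) , _)) (i′ , p′ , p′-ji) φa⊆φb =
      i≡i′ , Equivalence.from ≤D⇔≤ (implies (λ _ → p′) ≤-refl)
      where
      implies : ∀ x → p′ ≤ x i′ → p ≤ x i
      implies x = lower (g-generates _ (implicationSublattice i p i′ p′-ji) (λ j → lift λ p′≤gj →
        decidable-stable (p ≤? g j i) λ p≰gj → ∈φ.to (φa⊆φb (∈φ.from p≰gj)) p′≤gj) x)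
      spike : Fin k → Carrier
      spike l = ifDec (l Fin.≟ i′) (λ _ → p′) y
      p′≤spike : p′ ≤ spike i′
      p′≤spike = ifDec-intro {P = p′ ≤_} (i′ Fin.≟ i′) (λ _ → ≤-refl) (contradiction ≡.refl)
      i≡i′ : i ≡ i′
      i≡i′ with ifDec-elim {P = p ≤_} (i Fin.≟ i′) (implies spike p′≤spike)
      ... | inj₁ (i≡i′ , _) = i≡i′
      ... | inj₂ (_ , p≤y)  = contradiction p≤y (<⇒≱ (Equivalence.to <D⇔< y<p))

  module FromOrderEmbedding (k≥2 : 2 ℕ.≤ k) {n} (φ : kJ D k → Subset n)
                            (φ-emb : ∀ a b → _≤kJ_ D a b ⇔ (φ a ⊆ φ b))
                            {p₀} (p₀-ji : JoinIrreducible D p₀) where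
    open Bottom p₀

    φ-reflects : ∀ {i i′ p p′ jp jp′} → φ (i , p , jp) ⊆ φ (i′ , p′ , jp′) → i ≡ i′ × p ≤ p′
    φ-reflects φa⊆φb with Equivalence.from (φ-emb _ _) φa⊆φb
    ... | i≡i′ , p≤p′ = i≡i′ , Equivalence.to ≤D⇔≤ p≤p′

    φ-mono : ∀ {i p p′ jp jp′} → p ≤ p′ → φ (i , p , jp) ⊆ φ (i , p′ , jp′)
    φ-mono p≤p′ = Equivalence.to (φ-emb _ _) (≡.refl , Equivalence.from ≤D⇔≤ p≤p′)

    -- A full φ (i , p) would contain φ (i′ , p) for every other copy i′.
    φ-nonfull : ∀ i {p} (p-ji : JoinIrreducible D p) → ∃ λ j → j ∉ φ (i , p , p-ji)
    φ-nonfull i {p} p-ji with Fin.any? (λ j → ¬? (j Subset.∈? φ (i , p , p-ji)))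
    ... | yes j∉ = j∉
    ... | no ∄ with another k≥2 i
    ...   | i′ , i′≢i = contradiction (proj₁ (φ-reflects {i′} {i} {jp = p-ji} {p-ji} λ {j} _ →
                          decidable-stable (j Subset.∈? φ (i , p , p-ji)) (∄ ∘ (j ,_)))) i′≢i

    Avoids : Fin n → Fin k → Pred Carrier (c ⊔ ℓ)
    Avoids j l q = Σ (JoinIrreducible D q) λ q-ji → j ∉ φ (l , q , q-ji)

    avoids? : ∀ j l → Decidable (Avoids j l)
    avoids? j l q with joinIrreducible? q
    ... | no ¬q-ji = no (¬q-ji ∘ proj₁)
    ... | yes q-ji = map′ (q-ji ,_) (λ (_ , j∉) → j∉ ∘ φ-mono ≤-refl)
                          (¬? (j Subset.∈? φ (l , q , q-ji)))

    generator : Fin n → Fin k → Carrier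
    generator j l = ⋁[ ⊥ ] λ t → ifDec (avoids? j l (from t)) (λ _ → from t) ⊥

    ≤-generator⇔ : ∀ {q j l} (q-ji : JoinIrreducible D q) → q ≤ generator j l ⇔ j ∉ φ (l , q , q-ji)
    ≤-generator⇔ {q} {j} {l} q-ji = mk⇔ ≤⇒∉ ∉⇒≤
      where
      ≤⇒∉ : q ≤ generator j l → j ∉ φ (l , q , q-ji)
      ≤⇒∉ q≤g with ⋁-prime (joinIrreducible⇒joinPrime q-ji) q≤g
      ... | inj₁ q≤⊥ = contradiction q≤⊥ (joinIrreducible⇒≰⊥ q-ji)
      ... | inj₂ (t , q≤t) with ifDec-elim {P = q ≤_} (avoids? j l (from t)) q≤t
      ...   | inj₁ ((_ , j∉) , q≤from-t) = j∉ ∘ φ-mono q≤from-t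
      ...   | inj₂ (_ , q≤⊥) = contradiction q≤⊥ (joinIrreducible⇒≰⊥ q-ji)
      ∉⇒≤ : j ∉ φ (l , q , q-ji) → q ≤ generator j l
      ∉⇒≤ j∉ = ≤-trans (≤-reflexive (sym (from-to q)))
        (≤-trans (ifDec-intro {P = from (to q) ≤_} (avoids? j l (from (to q))) (λ _ → ≤-refl)
                   (λ ¬avoids → contradiction (joinIrreducible-resp (sym (from-to q)) q-ji ,
                                               j∉ ∘ φ-mono (≤-reflexive (from-to q))) ¬avoids))
                 (≤-⋁ ⊥ _ (to q)))

    z₀ : Fin k → Carrier
    z₀ = ⋀ᵏ[ generator j₀ ] generator
      where j₀ = proj₁ (φ-nonfull (Fin.fromℕ< k≥2) p₀-ji)

    -- Below every generator, q would have an empty φ (l , q), contained in φ (i′ , q) for i′ ≢ l.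
    joinIrreducible⇒≰z₀ : ∀ {q l} → JoinIrreducible D q → ¬ q ≤ z₀ l
    joinIrreducible⇒≰z₀ {q} {l} q-ji q≤z₀ with another k≥2 l
    ... | i′ , i′≢l = i′≢l (≡.sym (proj₁ (φ-reflects {l} {i′} {jp = q-ji} {q-ji} λ {j} j∈ →
      contradiction j∈
        (Equivalence.to (≤-generator⇔ q-ji) (≤-trans q≤z₀ (⋀ᵏ-≤ _ generator l j))))))

    outside : ∀ i {p} → JoinIrreducible D p → Fin n
    outside i p-ji = proj₁ (φ-nonfull i p-ji)

    atomFactor : ∀ i {p} → JoinIrreducible D p → Fin n → Fin k → Carrier
    atomFactor i p-ji j =
      ifDec (j Subset.∈? φ (i , _ , p-ji)) (λ _ → generator (outside i p-ji)) (generator j)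

    atom : ∀ i {p} → JoinIrreducible D p → Fin k → Carrier
    atom i p-ji = ⋀ᵏ[ generator (outside i p-ji) ] atomFactor i p-ji

    -- q ≤ atom i p at l says φ (l , q) ⊆ φ (i , p) by ≤-generator⇔, i.e. (l , q) ≤ (i , p).
    ≤-atom⇔ : ∀ {q l i p} (q-ji : JoinIrreducible D q) (p-ji : JoinIrreducible D p) →
              q ≤ atom i p-ji l ⇔ (l ≡ i × q ≤ p)
    ≤-atom⇔ {q} {l} {i} {p} q-ji p-ji = mk⇔ ≤⇒ ⇒≤
      where
      ≤⇒ : q ≤ atom i p-ji l → l ≡ i × q ≤ p
      ≤⇒ q≤atom = φ-reflects {jp = q-ji} {p-ji} λ {j} j∈ →
        decidable-stable (j Subset.∈? φ (i , p , p-ji)) λ j∉ →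
        Equivalence.to (≤-generator⇔ q-ji) (below-generator j∉) j∈
        where
        below-generator : ∀ {j} → j ∉ φ (i , p , p-ji) → q ≤ generator j l
        below-generator {j} j∉
          with ifDec-elim {P = λ v → q ≤ v l} {y = generator j} (j Subset.∈? φ (i , p , p-ji))
                          (≤-trans q≤atom (⋀ᵏ-≤ _ (atomFactor i p-ji) l j))
        ... | inj₁ (j∈ , _) = contradiction j∈ j∉
        ... | inj₂ (_ , q≤g) = q≤g
      ⇒≤ : l ≡ i × q ≤ p → q ≤ atom i p-ji l
      ⇒≤ (≡.refl , q≤p) = ⋀ᵏ-greatest _ (atomFactor l p-ji) l outside-bound λ j →
        ifDec-intro {P = λ v → q ≤ v l} {y = generator j} (j Subset.∈? φ (l , p , p-ji))
                    (λ _ → outside-bound) below-generator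
        where
        below-generator : ∀ {j} → j ∉ φ (l , p , p-ji) → q ≤ generator j l
        below-generator j∉ = Equivalence.from (≤-generator⇔ q-ji) (j∉ ∘ φ-mono q≤p)
        outside-bound = below-generator (proj₂ (φ-nonfull l p-ji))

    Contributes : (Fin k → Carrier) → Fin k → Pred (Fin m) (c ⊔ ℓ)
    Contributes x i t = JoinIrreducible D (from t) × from t ≤ x i

    contributes? : ∀ x i → Decidable (Contributes x i)
    contributes? x i t = joinIrreducible? (from t) ×-dec (from t ≤? x i)

    contribution : (Fin k → Carrier) → Fin k → Fin m → Fin k → Carrier
    contribution x i t = ifDec (contributes? x i t) (λ (t-ji , _) → atom i t-ji) z₀

    -- Every x is the join of the atoms of the join-irreducibles below its coordinates.
    rebuild : (Fin k → Carrier) → Fin k → Carrier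
    rebuild x = ⋁ᵏ[ z₀ ] λ i → ⋁ᵏ[ z₀ ] contribution x i

    ≤-rebuild⇔ : ∀ {q} x l → JoinIrreducible D q → q ≤ rebuild x l ⇔ q ≤ x l
    ≤-rebuild⇔ {q} x l q-ji = mk⇔ ≤⇒ ⇒≤
      where
      q-prime = joinIrreducible⇒joinPrime q-ji
      ≤⇒ : q ≤ rebuild x l → q ≤ x l
      ≤⇒ q≤ with ⋁ᵏ-prime z₀ (λ i → ⋁ᵏ[ z₀ ] contribution x i) l q-prime q≤
      ... | inj₁ q≤z₀ = contradiction q≤z₀ (joinIrreducible⇒≰z₀ q-ji)
      ... | inj₂ (i , q≤) with ⋁ᵏ-prime z₀ (contribution x i) l q-prime q≤
      ...   | inj₁ q≤z₀ = contradiction q≤z₀ (joinIrreducible⇒≰z₀ q-ji)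
      ...   | inj₂ (t , q≤) with ifDec-elim {P = λ v → q ≤ v l} {y = z₀} (contributes? x i t) q≤
      ...     | inj₂ (_ , q≤z₀) = contradiction q≤z₀ (joinIrreducible⇒≰z₀ q-ji)
      ...     | inj₁ ((t-ji , t≤xi) , q≤atom)
                  with Equivalence.to (≤-atom⇔ {l = l} {i} q-ji t-ji) q≤atom
      ...       | ≡.refl , q≤t = ≤-trans q≤t t≤xi
      ⇒≤ : q ≤ x l → q ≤ rebuild x l
      ⇒≤ q≤xl = ≤-trans q≤contribution (≤-trans (≤-⋁ᵏ z₀ (contribution x l) l (to q))
                                                (≤-⋁ᵏ z₀ (λ i → ⋁ᵏ[ z₀ ] contribution x i) l l))
        where
        q≈ = sym (from-to q)
        q≤contribution = ifDec-intro {P = λ v → q ≤ v l} {y = z₀} (contributes? x l (to q))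
          (λ (t-ji , _) → Equivalence.from (≤-atom⇔ q-ji t-ji) (≡.refl , ≤-reflexive q≈))
          (contradiction (joinIrreducible-resp q≈ q-ji , ≤-respˡ-≈ q≈ q≤xl))

    generates : Generates Dᵏ generator
    generates S S-sub generator∈S x = resp (λ l → ≤-antisym
      (≤-viaJoinIrreducibles λ q-ji → Equivalence.to (≤-rebuild⇔ x l q-ji))
      (≤-viaJoinIrreducibles λ q-ji → Equivalence.from (≤-rebuild⇔ x l q-ji))) rebuild∈S
      where
      open IsSublattice S-sub using (resp)
      z₀∈S : S z₀
      z₀∈S = ⋀ᵏ-closed S-sub (generator∈S _) generator∈S
      atom∈S : ∀ i {p} (p-ji : JoinIrreducible D p) → S (atom i p-ji)
      atom∈S i p-ji = ⋀ᵏ-closed S-sub (generator∈S _) λ j →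
        ifDec-intro {P = S} {y = generator j} (j Subset.∈? φ (i , _ , p-ji))
                    (λ _ → generator∈S _) (λ _ → generator∈S j)
      rebuild∈S : S (rebuild x)
      rebuild∈S = ⋁ᵏ-closed S-sub z₀∈S λ i → ⋁ᵏ-closed S-sub z₀∈S λ t →
        ifDec-intro {P = S} {y = z₀} (contributes? x i t) (λ (t-ji , _) → atom∈S i t-ji) (λ _ → z₀∈S)

  orderEmbedding⇒generating : 2 ℕ.≤ k → ∀ {n} → OrderEmbedsInto D k n →
                              ∃ λ n′ → n′ ℕ.≤ n × Σ (Fin n′ → Fin k → Carrier) (Generates Dᵏ)
  orderEmbedding⇒generating k≥2 {n} (φ , φ-emb) with Fin.any? (λ t → joinIrreducible? (from t))
  ... | yes (_ , t-ji) = n , ℕ.≤-refl , generator , generates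
    where open FromOrderEmbedding k≥2 φ φ-emb t-ji
  ... | no ∄ = 0 , z≤n , (λ ()) , λ S S-sub _ x →
    IsSublattice.resp S-sub (λ _ → ≤-antisym all-below all-below)
                            (proj₂ (IsSublattice.nonempty S-sub))
    where
    all-below : ∀ {x y} → x ≤ y
    all-below = ≤-viaJoinIrreducibles λ {p} p-ji _ →
      contradiction (to p , joinIrreducible-resp (sym (from-to p)) p-ji) ∄

  generating⇒hasGenSetOfSize≤ : ∀ {n} {g : Fin n → Fin k → Carrier} → Generates Dᵏ g →
                                ∃ λ n′ → n′ ℕ.≤ n × HasGenSetOfSize Dᵏ n′
  generating⇒hasGenSetOfSize≤ {g = g} g-generates =
    let n′ , n′≤n , g′ , g′-injective , g⊆g′ = deduplicate (Pointwise.decSetoid decSetoid k) g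
    in n′ , n′≤n , g′ , g′-injective , λ S S-sub g′∈S → g-generates S S-sub λ j →
         IsSublattice.resp S-sub (λ l → sym (proj₂ (g⊆g′ j) l)) (g′∈S (proj₁ (g⊆g′ j)))

  orderEmbedding⇒hasGenSetOfSize≤ : 2 ℕ.≤ k → ∀ {n} → OrderEmbedsInto D k n →
                                    ∃ λ n′ → n′ ℕ.≤ n × HasGenSetOfSize Dᵏ n′
  orderEmbedding⇒hasGenSetOfSize≤ k≥2 embeds =
    let n₁ , n₁≤n , _ , generates = orderEmbedding⇒generating k≥2 embeds
        n₂ , n₂≤n₁ , genSet       = generating⇒hasGenSetOfSize≤ generates
    in n₂ , ℕ.≤-trans n₂≤n₁ n₁≤n , genSet

  Table : ℕ → Set
  Table n = Vec (Vec (Subset n) m) k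

  _[_,_] : ∀ {n} → Table n → Fin k → Fin m → Subset n
  ψ [ i , t ] = lookup (lookup ψ i) t

  -- A table records an embedding on the join-irreducibles listed by from.
  IsEmbeddingTable : ∀ {n} → Pred (Table n) (c ⊔ ℓ)
  IsEmbeddingTable ψ = ∀ i t i′ t′ → JoinIrreducible D (from t) → JoinIrreducible D (from t′) →
    (i ≡ i′ × from t ≤ from t′) ⇔ (ψ [ i , t ] ⊆ ψ [ i′ , t′ ])

  isEmbeddingTable? : ∀ {n} → Decidable (IsEmbeddingTable {n})
  isEmbeddingTable? ψ = Fin.all? λ i → Fin.all? λ t → Fin.all? λ i′ → Fin.all? λ t′ →
    joinIrreducible? (from t) →-dec joinIrreducible? (from t′) →-dec
    ((i Fin.≟ i′) ×-dec (from t ≤? from t′)) ⇔-dec (ψ [ i , t ] Subset.⊆? ψ [ i′ , t′ ])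

  table⇒embedding : ∀ {n} → Σ (Table n) IsEmbeddingTable → OrderEmbedsInto D k n
  table⇒embedding (ψ , ψ-emb) =
    (λ (i , p , _) → ψ [ i , to p ]) , λ (i , p , p-ji) (i′ , p′ , p′-ji) →
    ⇔.trans (⇔.refl ×-⇔ ⇔.trans ≤D⇔≤ (≤-enumerated⇔ p p′))
            (ψ-emb i (to p) i′ (to p′) (joinIrreducible-resp (sym (from-to p)) p-ji)
                                       (joinIrreducible-resp (sym (from-to p′)) p′-ji))
    where
    ≤-enumerated⇔ : ∀ p p′ → p ≤ p′ ⇔ from (to p) ≤ from (to p′)
    ≤-enumerated⇔ p p′ = mk⇔ (≤-respˡ-≈ (sym (from-to p)) ∘ ≤-respʳ-≈ (sym (from-to p′)))
                             (≤-respˡ-≈ (from-to p) ∘ ≤-respʳ-≈ (from-to p′))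

  embedding⇒table : ∀ {n} → OrderEmbedsInto D k n → Σ (Table n) IsEmbeddingTable
  embedding⇒table {n} (φ , φ-emb) = ψ , ψ-emb
    where
    entry : Fin k → Fin m → Subset n
    entry i t = ifDec (joinIrreducible? (from t)) (λ t-ji → φ (i , from t , t-ji)) ∅
    ψ : Table n
    ψ = tabulate λ i → tabulate (entry i)
    ψ-entry : ∀ i t → JoinIrreducible D (from t) → ∃ λ t-ji → ψ [ i , t ] ≡ φ (i , from t , t-ji)
    ψ-entry i t t-ji =
      let jt , entry≡ = ifDec-intro {P = λ s → ∃ λ jt → s ≡ φ (i , from t , jt)} {y = ∅}
                          (joinIrreducible? (from t)) (λ jt → jt , ≡.refl) (contradiction t-ji)
      in jt , ≡.trans (≡.trans (≡.cong (λ row → lookup row t) (Vec.lookup∘tabulate _ i))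
                               (Vec.lookup∘tabulate _ t)) entry≡
    ψ-emb : IsEmbeddingTable ψ
    ψ-emb i t i′ t′ t-ji t′-ji with ψ-entry i t t-ji | ψ-entry i′ t′ t′-ji
    ... | jt , ψit≡ | jt′ , ψi′t′≡ =
      ⇔.trans (⇔.refl ×-⇔ ⇔.sym ≤D⇔≤)
              (≡.subst₂ (λ A B → _ ⇔ (A ⊆ B)) (≡.sym ψit≡) (≡.sym ψi′t′≡)
                        (φ-emb (i , _ , jt) (i′ , _ , jt′)))

  orderEmbedsInto? : ∀ n → Dec (OrderEmbedsInto D k n)
  orderEmbedsInto? n = map′ table⇒embedding embedding⇒table
    (searchable-Vec (searchable-Vec Subset.anySubset? m) k isEmbeddingTable?)

  initialEmbedding : OrderEmbedsInto D k (k ℕ.+ m)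
  initialEmbedding = φ , λ a b → mk⇔ (φ-mono a b) (φ-reflects a b)
    where
    -- φ (i , p) consists of the copies other than i, followed by the elements below p.
    Marked : Fin k → Carrier → Pred (Fin k ⊎ Fin m) ℓ
    Marked i p (inj₁ i′) = Lift ℓ (i′ ≢ i)
    Marked i p (inj₂ t)  = from t ≤ p
    marked? : ∀ i p → Decidable (Marked i p)
    marked? i p (inj₁ i′) = map′ lift lower (¬? (i′ Fin.≟ i))
    marked? i p (inj₂ t)  = from t ≤? p
    marked-mono : ∀ {i p p′} → p ≤ p′ → ∀ y → Marked i p y → Marked i p′ y
    marked-mono p≤p′ (inj₁ _) i′≢i = i′≢i
    marked-mono p≤p′ (inj₂ _) t≤p  = ≤-trans t≤p p≤p′
    φ : kJ D k → Subset (k ℕ.+ m)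
    φ (i , p , _) = subsetOf (marked? i p ∘ Fin.splitAt k)
    module ∈φ {i p x} = Equivalence (∈-subsetOf (marked? i p ∘ Fin.splitAt k) {x})
    join∈φ⇔ : ∀ i {p} (p-ji : JoinIrreducible D p) y → Fin.join k m y ∈ φ (i , p , p-ji) ⇔ Marked i p y
    join∈φ⇔ i {p} p-ji y = ≡.subst (λ z → (Fin.join k m y ∈ φ (i , p , p-ji)) ⇔ Marked i p z)
                                   (Fin.splitAt-join k m y) (∈-subsetOf (marked? i p ∘ Fin.splitAt k))
    φ-mono : ∀ a b → _≤kJ_ D a b → φ a ⊆ φ b
    φ-mono (i , p , _) (.i , p′ , _) (≡.refl , p≤p′) {x} x∈ =
      ∈φ.from (marked-mono (Equivalence.to ≤D⇔≤ p≤p′) (Fin.splitAt k x) (∈φ.to x∈))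
    φ-reflects : ∀ a b → φ a ⊆ φ b → _≤kJ_ D a b
    φ-reflects (i , p , p-ji) (i′ , p′ , p′-ji) φa⊆φb = i≡i′ , Equivalence.from ≤D⇔≤ p≤p′
      where
      transfer : ∀ y → Marked i p y → Marked i′ p′ y
      transfer y =
        Equivalence.to (join∈φ⇔ i′ p′-ji y) ∘ φa⊆φb ∘ Equivalence.from (join∈φ⇔ i p-ji y)
      i≡i′ : i ≡ i′
      i≡i′ = decidable-stable (i Fin.≟ i′) λ i≢i′ →
        lower (transfer (inj₁ i′) (lift (i≢i′ ∘ ≡.sym))) ≡.refl
      p≤p′ : p ≤ p′
      p≤p′ = ≤-respˡ-≈ (from-to p) (transfer (inj₂ (to p)) (≤-reflexive (from-to p)))

open import Data.Nat using (_≤_)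

theorem2p4 : ∀ {c ℓ : Level} (D : DistributiveLattice c ℓ) (m : ℕ) → IsFinite D m →
    (k : ℕ) → 2 ≤ k →
    ∃ λ n → IsLeast (HasGenSetOfSize (power (DistributiveLattice.rawLattice D) k)) n
          × IsLeast (OrderEmbedsInto D k) n
theorem2p4 D m fin k k≥2 = n₀ , (hasGenSet , genSet-least) , (embeds , embeds-least)
  where
  open Power D fin k
  leastEmbedding = least orderEmbedsInto? initialEmbedding
  n₀ = proj₁ leastEmbedding
  embeds = proj₁ (proj₂ leastEmbedding)
  embeds-least = proj₂ (proj₂ leastEmbedding)
  genSet-least : ∀ n → HasGenSetOfSize Dᵏ n → n₀ ℕ.≤ n
  genSet-least n (_ , _ , generates) = embeds-least n (generating⇒orderEmbedding generates)
  hasGenSet : HasGenSetOfSize Dᵏ n₀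
  hasGenSet =
    let n , n≤n₀ , genSet = orderEmbedding⇒hasGenSetOfSize≤ k≥2 embeds
    in ≡.subst (HasGenSetOfSize Dᵏ) (ℕ.≤-antisym n≤n₀ (genSet-least n genSet)) genSet
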